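{- If a $\Gamma$-labeled graph $G$ is $M$-connected, then $G$ is 2-connected and 3-edge-connected.
   Context: $\Gamma\cong\mathbb{Z}^k$. A $\Gamma$-labeled graph has edges from $K(V,\Gamma)$, the set of edges from $u$ to $v$ with label $\gamma$ ($u\ne v\in V$, $\gamma\in\Gamma$), where the edge from $u$ to $v$ with label $\gamma$ equals the edge from $v$ to $u$ with label $\gamma^{ -1}$; parallel edges with distinct labels are allowed. Connectivity refers to the underlying undirected multigraph. An edge set $F$ is balanced if every closed walk in $F$ has label product $\mathrm{id}$ (labels inverted when traversed backwards); $V(F)$ is the set of vertices incident to $F$. $E$ is independent if $|F|\le2|V(F)|-3$ for every nonempty balanced $F\subseteq E$ and $|F|\le 2|V(F)|-2$ for every nonempty $F\subseteq E$; this defines a matroid $\mathcal{R}_2(V)$. $G$ is $M$-connected if the restriction of $\mathcal{R}_2(V(G))$ to $E(G)$ is connected, i.e. $|E(G)|\ge2$ and every two edges lie in a common circuit. -}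

module Defs where

open import Data.Nat using (ℕ; _+_; _*_; _≤_)
open import Data.Integer as ℤ using (ℤ)
open import Data.Fin using (Fin; _≟_)
open import Data.Fin.Properties using (any?)
open import Data.Fin.Subset using (Subset; _∈_; _∉_; _⊆_; _⊂_; ∣_∣; Nonempty)
open import Data.Fin.Subset.Properties using (_∈?_)
open import Data.Vec using (Vec; replicate; tabulate; map; zipWith)
open import Data.Product using (Σ; ∃; _×_; _,_)
open import Data.Sum using (_⊎_)
open import Data.Unit using (⊤)
open import Relation.Nullary using (¬_; does)
open import Relation.Nullary.Decidable using (_×-dec_; _⊎-dec_)
open import Relation.Binary.PropositionalEquality using (_≡_; _≢_)

-- The group Γ ≅ ℤ^k, written additively: elements are vectors in ℤ^k.

Γ : ℕ → Set
Γ k = Vec ℤ k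

idΓ : ∀ {k} → Γ k
idΓ = replicate _ (ℤ.+ 0)

_·_ : ∀ {k} → Γ k → Γ k → Γ k
_·_ = zipWith ℤ._+_

inv : ∀ {k} → Γ k → Γ k
inv = map (λ a → ℤ.- a)

-- Γ-labeled edges on vertex set Fin n: an edge from u to v (u ≠ v)
-- with label γ.  The edge (u,v,γ) is identified with (v,u,γ⁻¹).

record Edge (n k : ℕ) : Set where
  constructor edge
  field
    tail  : Fin n
    head  : Fin n
    label : Γ k
    distinct : tail ≢ head
open Edge public

SameEdge : ∀ {n k} → Edge n k → Edge n k → Set
SameEdge e f =
  (tail e ≡ tail f × head e ≡ head f × label e ≡ label f)
  ⊎ (tail e ≡ head f × head e ≡ tail f × label e ≡ inv (label f))

-- A Γ-labeled graph: vertex set Fin n, edge set {E i | i : Fin m},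
-- with E injective modulo the identification above (E(G) is a set;
-- parallel edges with distinct labels are allowed).
record LGraph (n k : ℕ) : Set where
  field
    m     : ℕ
    E     : Fin m → Edge n k
    E-set : ∀ i j → SameEdge (E i) (E j) → i ≡ j
open LGraph public

module _ {n k : ℕ} (G : LGraph n k) where

  Traverses : Edge n k → Fin n → Fin n → Γ k → Set
  Traverses e x y δ =
    (tail e ≡ x × head e ≡ y × δ ≡ label e)
    ⊎ (head e ≡ x × tail e ≡ y × δ ≡ inv (label e))

  data LWalk (F : Subset (m G)) : Fin n → Fin n → Γ k → Set where
    nil  : ∀ {x} → LWalk F x x idΓ
    cons : ∀ {x y z δ γ} (i : Fin (m G)) → i ∈ F →
           Traverses (E G i) x y δ → LWalk F y z γ → LWalk F x z (δ · γ)

  Balanced : Subset (m G) → Set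
  Balanced F = ∀ x γ → LWalk F x x γ → γ ≡ idΓ

  Incident : Subset (m G) → Fin n → Set
  Incident F x = ∃ λ i → i ∈ F × (tail (E G i) ≡ x ⊎ head (E G i) ≡ x)

  VS : Subset (m G) → Subset n
  VS F = tabulate λ x →
    does (any? (λ i → (i ∈? F) ×-dec ((tail (E G i) ≟ x) ⊎-dec (head (E G i) ≟ x))))

  -- independence in R₂ restricted to E(G)
  Independent : Subset (m G) → Set
  Independent F = ∀ H → H ⊆ F → Nonempty H →
    (Balanced H → ∣ H ∣ + 3 ≤ 2 * ∣ VS H ∣) × (∣ H ∣ + 2 ≤ 2 * ∣ VS H ∣)

  Circuit : Subset (m G) → Set
  Circuit C = ¬ Independent C × (∀ D → D ⊂ C → Independent D)

  MConnected : Set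
  MConnected = 2 ≤ m G ×
    (∀ (e f : Fin (m G)) → e ≢ f → ∃ λ C → Circuit C × e ∈ C × f ∈ C)

  data Walk (Ok : Fin (m G) → Set) : Fin n → Fin n → Set where
    nil  : ∀ {x} → Walk Ok x x
    cons : ∀ {x y z δ} (i : Fin (m G)) → Ok i →
           Traverses (E G i) x y δ → Walk Ok y z → Walk Ok x z

  InV : Fin n → Set
  InV x = ∃ λ i → tail (E G i) ≡ x ⊎ head (E G i) ≡ x

  Connected : Set
  Connected = ∀ x y → InV x → InV y → Walk (λ _ → ⊤) x y

  TwoConnected : Set
  TwoConnected = Connected ×
    (∀ x → InV x → ∀ y z → InV y → InV z → y ≢ x → z ≢ x →
       Walk (λ i → tail (E G i) ≢ x × head (E G i) ≢ x) y z)

  ThreeEdgeConnected : Set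
  ThreeEdgeConnected = Connected ×
    (∀ (S : Subset (m G)) → ∣ S ∣ ≤ 2 → ∀ y z → InV y → InV z →
       Walk (λ i → i ∉ S) y z)

module Submission where

-- Write Count H for the two counting inequalities that define independence
-- (|H| + 3 ≤ 2|V(H)| if H is balanced, |H| + 2 ≤ 2|V(H)| always).  Every
-- proper nonempty subset of a circuit C satisfies Count, while C itself does
-- not (otherwise C would be independent).  Hence a circuit cannot be split:
--
--   * at a vertex: if C = C₁ ⊔ C₂ with both parts nonempty and V(C₁), V(C₂)
--     sharing at most one vertex, adding the counts of C₁ and C₂ gives Count C;
--   * by an edge cut: if a vertex set R is crossed by some but at most two
--     edges of C, adding the counts of the edges inside R and outside R gives
--     Count C (a balanced set of two crossing edges needs a parallel-edge
--     argument to have at least three vertices).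
--
-- For the graph part we grow, for a decidable set of admissible edges, the
-- component R of a vertex y (the vertices reachable from y).  If z ∉ R, the
-- edges of a circuit through an edge at y and an edge at z split C at the
-- removed vertex x (2-connectivity, and connectivity with no vertex removed)
-- or by the at most two removed edges (3-edge-connectivity).

open import Defs
open import Data.Nat using (ℕ; suc; _+_; _*_; _≤_; s≤s)
open import Data.Nat.Properties
  using (≤-refl; n≤1+n; ≤-trans; ≤-reflexive; m≤m+n; +-mono-≤; +-monoˡ-≤; *-monoʳ-≤;
         *-distribˡ-+; +-cancelʳ-≤; +-suc; module ≤-Reasoning)
open import Data.Nat.Tactic.RingSolver using (solve-∀)
open import Data.Integer as ℤ using (ℤ)
import Data.Integer.Properties as ℤ
open import Data.Bool using (true; false)
open import Data.Fin using (Fin; zero; suc; _≟_)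
open import Data.Fin.Properties using (any?)
open import Data.Fin.Subset
  using (Subset; _∈_; _∉_; _⊆_; _⊂_; _⊃_; ∣_∣; Nonempty; _∩_; _∪_; ∁; ⁅_⁆)
open import Data.Fin.Subset.Properties
  using (_∈?_; nonempty?; Empty-unique; ∣⊥∣≡0; ∣⁅x⁆∣≡1; x∈⁅x⁆; x∈⁅y⁆⇒x≡y; ⊆-antisym;
         p⊆q⇒∣p∣≤∣q∣; x∈p∧x≢y⇒x∈p-y; x∈p⇒∣p-x∣<∣p∣; p∩q⊆p; p∩q⊆q; x∈p∩q⁺;
         x∈p∪q⁺; x∈p∪q⁻; p⊆p∪q; x∈p⇒x∉∁p; x∉p⇒x∈∁p; x∈∁p⇒x∉p)
open import Data.Fin.Subset.Induction using (⊃-wellFounded)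
open import Induction.WellFounded using (Acc; acc)
open import Data.Vec using ([]; _∷_; tabulate)
import Data.Vec as Vec
open import Data.Vec.Properties using (lookup∘tabulate; lookup⇒[]=; []=⇒lookup)
open import Data.Product using (Σ; ∃; _×_; _,_; proj₁; proj₂)
open import Data.Sum using (_⊎_; inj₁; inj₂)
open import Data.Unit using (⊤; tt)
open import Data.Empty using (⊥; ⊥-elim)
open import Relation.Nullary using (¬_; Dec; yes; no; does)
open import Relation.Nullary.Decidable
  using (_×-dec_; _⊎-dec_; ¬?; dec-true; decidable-stable)
open import Relation.Binary.PropositionalEquality
  using (_≡_; _≢_; refl; sym; trans; cong; cong₂; subst; subst₂)
open import Function using (id; _∘_)

∣p∣≡∣p∩q∣+∣p∩∁q∣ : ∀ {N} (p q : Subset N) → ∣ p ∣ ≡ ∣ p ∩ q ∣ + ∣ p ∩ ∁ q ∣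
∣p∣≡∣p∩q∣+∣p∩∁q∣ [] [] = refl
∣p∣≡∣p∩q∣+∣p∩∁q∣ (true ∷ p) (true ∷ q) = cong suc (∣p∣≡∣p∩q∣+∣p∩∁q∣ p q)
∣p∣≡∣p∩q∣+∣p∩∁q∣ (true ∷ p) (false ∷ q) =
  trans (cong suc (∣p∣≡∣p∩q∣+∣p∩∁q∣ p q)) (sym (+-suc _ _))
∣p∣≡∣p∩q∣+∣p∩∁q∣ (false ∷ p) (true ∷ q) = ∣p∣≡∣p∩q∣+∣p∩∁q∣ p q
∣p∣≡∣p∩q∣+∣p∩∁q∣ (false ∷ p) (false ∷ q) = ∣p∣≡∣p∩q∣+∣p∩∁q∣ p q

∣p∣+∣q∣≡∣p∪q∣+∣p∩q∣ : ∀ {N} (p q : Subset N) → ∣ p ∣ + ∣ q ∣ ≡ ∣ p ∪ q ∣ + ∣ p ∩ q ∣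
∣p∣+∣q∣≡∣p∪q∣+∣p∩q∣ [] [] = refl
∣p∣+∣q∣≡∣p∪q∣+∣p∩q∣ (true ∷ p) (true ∷ q) =
  cong suc (trans (+-suc _ _) (trans (cong suc (∣p∣+∣q∣≡∣p∪q∣+∣p∩q∣ p q)) (sym (+-suc _ _))))
∣p∣+∣q∣≡∣p∪q∣+∣p∩q∣ (true ∷ p) (false ∷ q) = cong suc (∣p∣+∣q∣≡∣p∪q∣+∣p∩q∣ p q)
∣p∣+∣q∣≡∣p∪q∣+∣p∩q∣ (false ∷ p) (true ∷ q) =
  trans (+-suc _ _) (cong suc (∣p∣+∣q∣≡∣p∪q∣+∣p∩q∣ p q))
∣p∣+∣q∣≡∣p∪q∣+∣p∩q∣ (false ∷ p) (false ∷ q) = ∣p∣+∣q∣≡∣p∪q∣+∣p∩q∣ p q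

cover-≤ : ∀ {N} {p : Subset N} (q r : Subset N) → p ⊆ q ∪ r → ∣ p ∣ ≤ ∣ q ∣ + ∣ r ∣
cover-≤ q r p⊆q∪r = ≤-trans (p⊆q⇒∣p∣≤∣q∣ p⊆q∪r)
  (≤-trans (m≤m+n _ ∣ q ∩ r ∣) (≤-reflexive (sym (∣p∣+∣q∣≡∣p∪q∣+∣p∩q∣ q r))))

∣p∣≤1 : ∀ {N} {p : Subset N} (x : Fin N) → (∀ {u} → u ∈ p → u ≡ x) → ∣ p ∣ ≤ 1
∣p∣≤1 x only-x = ≤-trans (p⊆q⇒∣p∣≤∣q∣ (λ u∈p → subst (_∈ ⁅ x ⁆) (sym (only-x u∈p)) (x∈⁅x⁆ x)))
                          (≤-reflexive (∣⁅x⁆∣≡1 x))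

∈⇒1≤∣p∣ : ∀ {N} {p : Subset N} {x} → x ∈ p → 1 ≤ ∣ p ∣
∈⇒1≤∣p∣ {x = x} x∈p = ≤-trans (≤-reflexive (sym (∣⁅x⁆∣≡1 x)))
  (p⊆q⇒∣p∣≤∣q∣ (λ u∈⁅x⁆ → subst (_∈ _) (sym (x∈⁅y⁆⇒x≡y x u∈⁅x⁆)) x∈p))

∈⇒2≤∣p∣ : ∀ {N} {p : Subset N} {x y} → x ∈ p → y ∈ p → x ≢ y → 2 ≤ ∣ p ∣
∈⇒2≤∣p∣ x∈p y∈p x≢y = ≤-trans (s≤s (∈⇒1≤∣p∣ (x∈p∧x≢y⇒x∈p-y y∈p (x≢y ∘ sym))))
                                (x∈p⇒∣p-x∣<∣p∣ x∈p)

∣∅∣≡0 : ∀ {N} (p : Subset N) → ¬ Nonempty p → ∣ p ∣ ≡ 0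
∣∅∣≡0 {N} p empty = trans (cong ∣_∣ (Empty-unique empty)) (∣⊥∣≡0 N)

⟪_⟫ : ∀ {N} {P : Fin N → Set} → (∀ i → Dec (P i)) → Subset N
⟪ P? ⟫ = tabulate (λ i → does (P? i))

∈⟪⟫⁺ : ∀ {N} {P : Fin N → Set} (P? : ∀ i → Dec (P i)) {i} → P i → i ∈ ⟪ P? ⟫
∈⟪⟫⁺ P? {i} p = lookup⇒[]= i _ (trans (lookup∘tabulate (λ j → does (P? j)) i) (dec-true (P? i) p))

∈⟪⟫⁻ : ∀ {N} {P : Fin N → Set} (P? : ∀ i → Dec (P i)) {i} → i ∈ ⟪ P? ⟫ → P i
∈⟪⟫⁻ P? {i} i∈ with P? i | trans (sym (lookup∘tabulate (λ j → does (P? j)) i)) ([]=⇒lookup i∈)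
... | yes p | _  = p
... | no _  | ()

inv-involutive : ∀ {k} (a : Γ k) → inv (inv a) ≡ a
inv-involutive [] = refl
inv-involutive (x ∷ a) = cong₂ _∷_ (ℤ.neg-involutive x) (inv-involutive a)

-- The label of a closed walk a → b → a along labels δ₁, δ₂ is id only if δ₁ = δ₂.
closed-pair-label : ∀ {k} (δ₁ δ₂ : Γ k) → δ₁ · (inv δ₂ · idΓ) ≡ idΓ → δ₁ ≡ δ₂
closed-pair-label [] [] _ = refl
closed-pair-label (x ∷ δ₁) (y ∷ δ₂) eq = cong₂ _∷_
  (ℤ.i-j≡0⇒i≡j x y (trans (cong (ℤ._+_ x) (sym (ℤ.+-identityʳ (ℤ.- y)))) (cong Vec.head eq)))
  (closed-pair-label δ₁ δ₂ (cong Vec.tail eq))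

add-counts : ∀ {c₁ c₂} h₁ h₂ v₁ v₂ → h₁ + c₁ ≤ 2 * v₁ → h₂ + c₂ ≤ 2 * v₂ →
  (h₁ + h₂) + (c₁ + c₂) ≤ 2 * (v₁ + v₂)
add-counts {c₁} {c₂} h₁ h₂ v₁ v₂ count₁ count₂ = begin
  (h₁ + h₂) + (c₁ + c₂)  ≡⟨ interchange h₁ h₂ c₁ c₂ ⟩
  (h₁ + c₁) + (h₂ + c₂)  ≤⟨ +-mono-≤ count₁ count₂ ⟩
  2 * v₁ + 2 * v₂        ≡⟨ *-distribˡ-+ 2 v₁ v₂ ⟨
  2 * (v₁ + v₂)          ∎
  where
  open ≤-Reasoning
  interchange : ∀ a b c d → (a + b) + (c + d) ≡ (a + c) + (b + d)
  interchange = solve-∀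

absorb-slack : ∀ {s} h v c → h + s ≤ 2 * v + 2 → 2 + c ≤ s → h + c ≤ 2 * v
absorb-slack {s} h v c total enough = +-cancelʳ-≤ 2 (h + c) (2 * v) (begin
  (h + c) + 2     ≡⟨ rearrange h c ⟩
  h + (2 + c)     ≤⟨ +-mono-≤ (≤-refl {h}) enough ⟩
  h + s           ≤⟨ total ⟩
  2 * v + 2       ∎)
  where
  open ≤-Reasoning
  rearrange : ∀ a b → (a + b) + 2 ≡ a + (2 + b)
  rearrange = solve-∀

small-count : ∀ {h v} → h ≤ 2 → 3 ≤ v → h + 3 ≤ 2 * v
small-count h≤2 3≤v = ≤-trans (+-monoˡ-≤ 3 h≤2) (≤-trans (n≤1+n 5) (*-monoʳ-≤ 2 3≤v))

another-edge : ∀ {M} → 2 ≤ M → (e : Fin M) → ∃ λ f → e ≢ f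
another-edge (s≤s (s≤s _)) zero = suc zero , λ ()
another-edge (s≤s (s≤s _)) (suc e) = zero , λ ()

module _ {n k : ℕ} (G : LGraph n k) where

  tl hd : Fin (m G) → Fin n
  tl i = tail (E G i)
  hd i = head (E G i)

  Ends : Fin (m G) → Fin n → Set
  Ends i u = tl i ≡ u ⊎ hd i ≡ u

  incident? : ∀ H x → Dec (Incident G H x)
  incident? H x = any? (λ i → (i ∈? H) ×-dec ((tl i ≟ x) ⊎-dec (hd i ≟ x)))

  VS⁺ : ∀ {H i u} → i ∈ H → Ends i u → u ∈ VS G H
  VS⁺ {H} i∈H i-at-u = ∈⟪⟫⁺ (incident? H) (_ , i∈H , i-at-u)

  VS⁻ : ∀ {H u} → u ∈ VS G H → Incident G H u
  VS⁻ {H} = ∈⟪⟫⁻ (incident? H)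

  VS-⊆ : ∀ {H W} → (∀ {i u} → i ∈ H → Ends i u → u ∈ W) → VS G H ⊆ W
  VS-⊆ ends∈W u∈VS with VS⁻ u∈VS
  ... | _ , i∈H , i-at-u = ends∈W i∈H i-at-u

  VS-mono : ∀ {H H′} → H ⊆ H′ → VS G H ⊆ VS G H′
  VS-mono H⊆H′ = VS-⊆ (λ i∈H → VS⁺ (H⊆H′ i∈H))

  balanced-mono : ∀ {H H′} → H ⊆ H′ → Balanced G H′ → Balanced G H
  balanced-mono {H} {H′} H⊆H′ balanced x γ w = balanced x γ (widen w)
    where
    widen : ∀ {a b δ} → LWalk G H a b δ → LWalk G H′ a b δ
    widen nil = nil
    widen (cons i i∈H t w) = cons i (H⊆H′ i∈H) t (widen w)

  Count : Subset (m G) → Set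
  Count H = (Balanced G H → ∣ H ∣ + 3 ≤ 2 * ∣ VS G H ∣) × (∣ H ∣ + 2 ≤ 2 * ∣ VS G H ∣)

  proper-count : ∀ {C D} → Circuit G C → D ⊂ C → Nonempty D → Count D
  proper-count (_ , minimal) D⊂C nonempty = minimal _ D⊂C _ id nonempty

  -- ... but the circuit itself is not: otherwise every nonempty H ⊆ C would
  -- be counted (either H ⊂ C, or H = C), making C independent.
  circuit-uncounted : ∀ {C} → Circuit G C → ¬ Count C
  circuit-uncounted {C} (dependent , minimal) count-C = dependent independent
    where
    independent : Independent G C
    independent H H⊆C nonempty with any? (λ i → (i ∈? C) ×-dec ¬? (i ∈? H))
    ... | yes (i , i∈C , i∉H) = minimal H (H⊆C , i , i∈C , i∉H) H id nonempty
    ... | no C⊈H = subst Count (⊆-antisym C⊆H H⊆C) count-C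
      where
      C⊆H : C ⊆ H
      C⊆H {i} i∈C = decidable-stable (i ∈? H) (λ i∉H → C⊈H (i , i∈C , i∉H))

  count-across-vertex : ∀ H X (x : Fin n) →
    (∀ {u} → u ∈ VS G (H ∩ X) → u ∈ VS G (H ∩ ∁ X) → u ≡ x) → ∀ c₁ c₂ →
    ∣ H ∩ X ∣ + c₁ ≤ 2 * ∣ VS G (H ∩ X) ∣ → ∣ H ∩ ∁ X ∣ + c₂ ≤ 2 * ∣ VS G (H ∩ ∁ X) ∣ →
    ∣ H ∣ + (c₁ + c₂) ≤ 2 * ∣ VS G H ∣ + 2
  count-across-vertex H X x shared c₁ c₂ part₁ part₂ = begin
    ∣ H ∣ + (c₁ + c₂)               ≡⟨ cong (_+ (c₁ + c₂)) (∣p∣≡∣p∩q∣+∣p∩∁q∣ H X) ⟩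
    (∣ H₁ ∣ + ∣ H₂ ∣) + (c₁ + c₂)   ≤⟨ add-counts (∣ H₁ ∣) (∣ H₂ ∣) (∣ V₁ ∣) (∣ V₂ ∣) part₁ part₂ ⟩
    2 * (∣ V₁ ∣ + ∣ V₂ ∣)           ≤⟨ *-monoʳ-≤ 2 vertices ⟩
    2 * (∣ VS G H ∣ + 1)            ≡⟨ *-distribˡ-+ 2 ∣ VS G H ∣ 1 ⟩
    2 * ∣ VS G H ∣ + 2              ∎
    where
    open ≤-Reasoning
    H₁ H₂ : Subset (m G)
    H₁ = H ∩ X
    H₂ = H ∩ ∁ X
    V₁ V₂ : Subset n
    V₁ = VS G H₁
    V₂ = VS G H₂
    V₁∪V₂⊆V : V₁ ∪ V₂ ⊆ VS G H
    V₁∪V₂⊆V u∈ with x∈p∪q⁻ V₁ V₂ u∈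
    ... | inj₁ u∈V₁ = VS-mono (p∩q⊆p H X) u∈V₁
    ... | inj₂ u∈V₂ = VS-mono (p∩q⊆p H (∁ X)) u∈V₂
    -- by inclusion–exclusion, since V₁ ∩ V₂ ⊆ {x}
    vertices : ∣ V₁ ∣ + ∣ V₂ ∣ ≤ ∣ VS G H ∣ + 1
    vertices = ≤-trans (≤-reflexive (∣p∣+∣q∣≡∣p∪q∣+∣p∩q∣ V₁ V₂))
      (+-mono-≤ (p⊆q⇒∣p∣≤∣q∣ V₁∪V₂⊆V) (∣p∣≤1 x (λ u∈ → shared (p∩q⊆p V₁ V₂ u∈) (p∩q⊆q V₁ V₂ u∈))))

  circuit-no-cut-vertex : ∀ {C} → Circuit G C → (X : Subset (m G)) {e f : Fin (m G)} →
    e ∈ C → e ∈ X → f ∈ C → f ∉ X → (x : Fin n) →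
    (∀ {u} → u ∈ VS G (C ∩ X) → u ∈ VS G (C ∩ ∁ X) → u ≡ x) → ⊥
  circuit-no-cut-vertex {C} circuit X {e} {f} e∈C e∈X f∈C f∉X x shared = circuit-uncounted circuit
    ( (λ balanced → absorb-slack (∣ C ∣) (∣ VS G C ∣) 3
         (count-across-vertex C X x shared 3 3 (proj₁ count₁ (balanced-mono (p∩q⊆p C X) balanced))
                                                   (proj₁ count₂ (balanced-mono (p∩q⊆p C (∁ X)) balanced)))
         (n≤1+n 5))
    , absorb-slack (∣ C ∣) (∣ VS G C ∣) 2
        (count-across-vertex C X x shared 2 2 (proj₂ count₁) (proj₂ count₂)) ≤-refl)
    where
    -- both parts are proper: f is missing from the first, e from the second
    count₁ : Count (C ∩ X)
    count₁ = proper-count circuit (p∩q⊆p C X , f , f∈C , f∉X ∘ p∩q⊆q C X) (e , x∈p∩q⁺ (e∈C , e∈X))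
    count₂ : Count (C ∩ ∁ X)
    count₂ = proper-count circuit (p∩q⊆p C (∁ X) , e , e∈C , x∈p⇒x∉∁p e∈X ∘ p∩q⊆q C (∁ X))
                                  (f , x∈p∩q⁺ (f∈C , x∉p⇒x∈∁p f∉X))

  traversal-ends : ∀ {i a b δ} → Traverses G (E G i) a b δ → Ends i a × Ends i b
  traversal-ends (inj₁ (tl≡a , hd≡b , _)) = inj₁ tl≡a , inj₂ hd≡b
  traversal-ends (inj₂ (hd≡a , tl≡b , _)) = inj₂ hd≡a , inj₁ tl≡b

  reverse : ∀ {i a b δ} → Traverses G (E G i) a b δ → Traverses G (E G i) b a (inv δ)
  reverse (inj₁ (tl≡a , hd≡b , δ≡)) = inj₂ (hd≡b , tl≡a , cong inv δ≡)
  reverse (inj₂ (hd≡a , tl≡b , δ≡)) = inj₁ (tl≡b , hd≡a , trans (cong inv δ≡) (inv-involutive _))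

  traversal-unique : ∀ {i j a b δ} → Traverses G (E G i) a b δ → Traverses G (E G j) a b δ → i ≡ j
  traversal-unique {i} {j} (inj₁ (t , h , l)) (inj₁ (t′ , h′ , l′)) =
    E-set G i j (inj₁ (trans t (sym t′) , trans h (sym h′) , trans (sym l) l′))
  traversal-unique {i} {j} (inj₁ (t , h , l)) (inj₂ (h′ , t′ , l′)) =
    E-set G i j (inj₂ (trans t (sym h′) , trans h (sym t′) , trans (sym l) l′))
  traversal-unique {i} {j} (inj₂ (h , t , l)) (inj₁ (t′ , h′ , l′)) =
    E-set G i j (inj₂ (trans t (sym h′) , trans h (sym t′) ,
      trans (sym (inv-involutive _)) (cong inv (trans (sym l) l′))))
  traversal-unique {i} {j} (inj₂ (h , t , l)) (inj₂ (h′ , t′ , l′)) =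
    E-set G i j (inj₁ (trans t (sym t′) , trans h (sym h′) ,
      trans (sym (inv-involutive _)) (trans (cong inv (trans (sym l) l′)) (inv-involutive _))))

  -- A balanced set contains no two distinct parallel edges a → b: going
  -- out along one and back along the other is a closed walk of label
  -- δ₁ · δ₂⁻¹, so δ₁ = δ₂, and then the edges coincide.
  balanced-parallel : ∀ {H i j a b δ₁ δ₂} → Balanced G H → i ∈ H → j ∈ H →
    Traverses G (E G i) a b δ₁ → Traverses G (E G j) a b δ₂ → i ≡ j
  balanced-parallel {j = j} {a} {b} {δ₁} {δ₂} balanced i∈H j∈H t₁ t₂ =
    traversal-unique t₁ (subst (Traverses G (E G j) a b) (sym δ₁≡δ₂) t₂)
    where
    δ₁≡δ₂ : δ₁ ≡ δ₂
    δ₁≡δ₂ = closed-pair-label δ₁ δ₂ (balanced a _ (cons _ i∈H t₁ (cons _ j∈H (reverse t₂) nil)))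

  Inside Outside Crosses : Subset n → Fin (m G) → Set
  Inside R i = tl i ∈ R × hd i ∈ R
  Outside R i = tl i ∉ R × hd i ∉ R
  Crosses R i = (tl i ∈ R × hd i ∉ R) ⊎ (hd i ∈ R × tl i ∉ R)

  inside? : ∀ R i → Dec (Inside R i)
  inside? R i = (tl i ∈? R) ×-dec (hd i ∈? R)
  outside? : ∀ R i → Dec (Outside R i)
  outside? R i = ¬? (tl i ∈? R) ×-dec ¬? (hd i ∈? R)
  crosses? : ∀ R i → Dec (Crosses R i)
  crosses? R i = ((tl i ∈? R) ×-dec ¬? (hd i ∈? R)) ⊎-dec ((hd i ∈? R) ×-dec ¬? (tl i ∈? R))

  classify : ∀ R i → Inside R i ⊎ Outside R i ⊎ Crosses R i
  classify R i with tl i ∈? R | hd i ∈? R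
  ... | yes tl∈R | yes hd∈R = inj₁ (tl∈R , hd∈R)
  ... | no  tl∉R | no  hd∉R = inj₂ (inj₁ (tl∉R , hd∉R))
  ... | yes tl∈R | no  hd∉R = inj₂ (inj₂ (inj₁ (tl∈R , hd∉R)))
  ... | no  tl∉R | yes hd∈R = inj₂ (inj₂ (inj₂ (hd∈R , tl∉R)))

  record Exit (R : Subset n) (i : Fin (m G)) : Set where
    field
      inner outer : Fin n
      δ : Γ k
      traversal : Traverses G (E G i) inner outer δ
      inner∈R : inner ∈ R
      outer∉R : outer ∉ R

  exit : ∀ {R i} → Crosses R i → Exit R i
  exit (inj₁ (tl∈R , hd∉R)) = record
    { traversal = inj₁ (refl , refl , refl) ; inner∈R = tl∈R ; outer∉R = hd∉R }
  exit (inj₂ (hd∈R , tl∉R)) = record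
    { traversal = inj₂ (refl , refl , refl) ; inner∈R = hd∈R ; outer∉R = tl∉R }

  exit-crosses : ∀ {R i} → Exit R i → Crosses R i
  exit-crosses record { traversal = inj₁ (tl≡a , hd≡b , _) ; inner∈R = a∈R ; outer∉R = b∉R } =
    inj₁ (subst (_∈ _) (sym tl≡a) a∈R , subst (_∉ _) (sym hd≡b) b∉R)
  exit-crosses record { traversal = inj₂ (hd≡a , tl≡b , _) ; inner∈R = a∈R ; outer∉R = b∉R } =
    inj₂ (subst (_∈ _) (sym hd≡a) a∈R , subst (_∉ _) (sym tl≡b) b∉R)

  exit-ends : ∀ {H R i} → i ∈ H → (x : Exit R i) →
    Exit.inner x ∈ VS G H ∩ R × Exit.outer x ∈ VS G H ∩ ∁ R
  exit-ends i∈H x = x∈p∩q⁺ (VS⁺ i∈H (proj₁ ends) , inner∈R)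
                  , x∈p∩q⁺ (VS⁺ i∈H (proj₂ ends) , x∉p⇒x∈∁p outer∉R)
    where
    open Exit x
    ends : Ends _ inner × Ends _ outer
    ends = traversal-ends traversal

  -- Two distinct edges of a balanced set H that cross R have at least three
  -- ends: otherwise they would be parallel and equally oriented.
  crossing-pair-ends : ∀ {H R e f} → Balanced G H → e ∈ H → f ∈ H → e ≢ f →
    Crosses R e → Crosses R f → 3 ≤ ∣ VS G H ∩ R ∣ + ∣ VS G H ∩ ∁ R ∣
  crossing-pair-ends {H} {R} {f = f} balanced e∈H f∈H e≢f e-crosses f-crosses =
    count-ends (E.inner ≟ F.inner) (E.outer ≟ F.outer)
    where
    module E = Exit (exit e-crosses)
    module F = Exit (exit f-crosses)
    e-ends : E.inner ∈ VS G H ∩ R × E.outer ∈ VS G H ∩ ∁ R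
    e-ends = exit-ends e∈H (exit e-crosses)
    f-ends : F.inner ∈ VS G H ∩ R × F.outer ∈ VS G H ∩ ∁ R
    f-ends = exit-ends f∈H (exit f-crosses)
    count-ends : Dec (E.inner ≡ F.inner) → Dec (E.outer ≡ F.outer) →
      3 ≤ ∣ VS G H ∩ R ∣ + ∣ VS G H ∩ ∁ R ∣
    count-ends (no inner≢) _ =
      +-mono-≤ (∈⇒2≤∣p∣ (proj₁ e-ends) (proj₁ f-ends) inner≢) (∈⇒1≤∣p∣ (proj₂ e-ends))
    count-ends (yes _) (no outer≢) =
      +-mono-≤ (∈⇒1≤∣p∣ (proj₁ e-ends)) (∈⇒2≤∣p∣ (proj₂ e-ends) (proj₂ f-ends) outer≢)
    count-ends (yes inner≡) (yes outer≡) = ⊥-elim (e≢f (balanced-parallel balanced e∈H f∈H E.traversal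
      (subst₂ (λ a b → Traverses G (E G f) a b F.δ) (sym inner≡) (sym outer≡) F.traversal)))

  crosses⇒¬inside : ∀ {R i} → Crosses R i → ¬ Inside R i
  crosses⇒¬inside (inj₁ (_ , hd∉R)) (_ , hd∈R) = hd∉R hd∈R
  crosses⇒¬inside (inj₂ (_ , tl∉R)) (tl∈R , _) = tl∉R tl∈R

  crosses⇒¬outside : ∀ {R i} → Crosses R i → ¬ Outside R i
  crosses⇒¬outside (inj₁ (tl∈R , _)) (tl∉R , _) = tl∉R tl∈R
  crosses⇒¬outside (inj₂ (hd∈R , _)) (_ , hd∉R) = hd∉R hd∈R

  inside-part outside-part cut-part : Subset (m G) → Subset n → Subset (m G)
  inside-part H R = H ∩ ⟪ inside? R ⟫
  outside-part H R = H ∩ ⟪ outside? R ⟫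
  cut-part H R = H ∩ ⟪ crosses? R ⟫

  cut-split : ∀ H R →
    ∣ H ∣ ≤ (∣ inside-part H R ∣ + ∣ outside-part H R ∣) + ∣ cut-part H R ∣
  cut-split H R = ≤-trans (cover-≤ (inside-part H R ∪ outside-part H R) (cut-part H R) H⊆)
                          (+-monoˡ-≤ ∣ cut-part H R ∣ (cover-≤ (inside-part H R) (outside-part H R) id))
    where
    H⊆ : H ⊆ (inside-part H R ∪ outside-part H R) ∪ cut-part H R
    H⊆ {i} i∈H with classify R i
    ... | inj₁ inside = x∈p∪q⁺ (inj₁ (x∈p∪q⁺ (inj₁ (x∈p∩q⁺ (i∈H , ∈⟪⟫⁺ (inside? R) inside)))))
    ... | inj₂ (inj₁ outside) = x∈p∪q⁺ (inj₁ (x∈p∪q⁺ (inj₂ (x∈p∩q⁺ (i∈H , ∈⟪⟫⁺ (outside? R) outside)))))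
    ... | inj₂ (inj₂ crosses) = x∈p∪q⁺ (inj₂ (x∈p∩q⁺ (i∈H , ∈⟪⟫⁺ (crosses? R) crosses)))

  inside-vertices : ∀ H R → VS G (inside-part H R) ⊆ VS G H ∩ R
  inside-vertices H R = VS-⊆ λ i∈ i-at-u →
    x∈p∩q⁺ (VS⁺ (p∩q⊆p H _ i∈) i-at-u , end∈R (∈⟪⟫⁻ (inside? R) (p∩q⊆q H _ i∈)) i-at-u)
    where
    end∈R : ∀ {i u} → Inside R i → Ends i u → u ∈ R
    end∈R (tl∈R , _) (inj₁ tl≡u) = subst (_∈ R) tl≡u tl∈R
    end∈R (_ , hd∈R) (inj₂ hd≡u) = subst (_∈ R) hd≡u hd∈R

  outside-vertices : ∀ H R → VS G (outside-part H R) ⊆ VS G H ∩ ∁ R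
  outside-vertices H R = VS-⊆ λ i∈ i-at-u →
    x∈p∩q⁺ (VS⁺ (p∩q⊆p H _ i∈) i-at-u , x∉p⇒x∈∁p (end∉R (∈⟪⟫⁻ (outside? R) (p∩q⊆q H _ i∈)) i-at-u))
    where
    end∉R : ∀ {i u} → Outside R i → Ends i u → u ∉ R
    end∉R (tl∉R , _) (inj₁ tl≡u) = subst (_∉ R) tl≡u tl∉R
    end∉R (_ , hd∉R) (inj₂ hd≡u) = subst (_∉ R) hd≡u hd∉R

  count-across-cut : ∀ H R → ∣ cut-part H R ∣ ≤ 2 → ∀ c₁ c₂ →
    ∣ inside-part H R ∣ + c₁ ≤ 2 * ∣ VS G H ∩ R ∣ → ∣ outside-part H R ∣ + c₂ ≤ 2 * ∣ VS G H ∩ ∁ R ∣ →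
    ∣ H ∣ + (c₁ + c₂) ≤ 2 * ∣ VS G H ∣ + 2
  count-across-cut H R cut≤2 c₁ c₂ inside outside = begin
    ∣ H ∣ + (c₁ + c₂)                               ≤⟨ +-monoˡ-≤ (c₁ + c₂) (cut-split H R) ⟩
    ((∣ Hin ∣ + ∣ Hout ∣) + ∣ Hcut ∣) + (c₁ + c₂)   ≡⟨ swap (∣ Hin ∣ + ∣ Hout ∣) (∣ Hcut ∣) (c₁ + c₂) ⟩
    ((∣ Hin ∣ + ∣ Hout ∣) + (c₁ + c₂)) + ∣ Hcut ∣   ≤⟨ +-mono-≤ sides cut≤2 ⟩
    2 * (∣ V ∩ R ∣ + ∣ V ∩ ∁ R ∣) + 2               ≡⟨ cong (λ v → 2 * v + 2) (∣p∣≡∣p∩q∣+∣p∩∁q∣ V R) ⟨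
    2 * ∣ V ∣ + 2                                   ∎
    where
    open ≤-Reasoning
    Hin Hout Hcut : Subset (m G)
    Hin = inside-part H R
    Hout = outside-part H R
    Hcut = cut-part H R
    V : Subset n
    V = VS G H
    swap : ∀ x y z → (x + y) + z ≡ (x + z) + y
    swap = solve-∀
    sides : (∣ Hin ∣ + ∣ Hout ∣) + (c₁ + c₂) ≤ 2 * (∣ V ∩ R ∣ + ∣ V ∩ ∁ R ∣)
    sides = add-counts (∣ Hin ∣) (∣ Hout ∣) (∣ V ∩ R ∣) (∣ V ∩ ∁ R ∣) inside outside

  -- The count of a proper part S of a circuit, measured against a vertex
  -- set W ⊇ V(S); an empty part still satisfies the unbalanced count if W ≠ ∅.
  part-count : ∀ {C S W} → Circuit G C → S ⊂ C → VS G S ⊆ W → 1 ≤ ∣ W ∣ →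
    ∣ S ∣ + 2 ≤ 2 * ∣ W ∣
  part-count {S = S} {W} circuit S⊂C V⊆W 1≤W with nonempty? S
  ... | yes nonempty = ≤-trans (proj₂ (proper-count circuit S⊂C nonempty)) (*-monoʳ-≤ 2 (p⊆q⇒∣p∣≤∣q∣ V⊆W))
  ... | no empty = subst (λ s → s + 2 ≤ 2 * ∣ W ∣) (sym (∣∅∣≡0 S empty)) (*-monoʳ-≤ 2 1≤W)

  part-count-balanced : ∀ {C S W} → Circuit G C → S ⊂ C → VS G S ⊆ W → Nonempty S →
    Balanced G S → ∣ S ∣ + 3 ≤ 2 * ∣ W ∣
  part-count-balanced circuit S⊂C V⊆W nonempty balanced =
    ≤-trans (proj₁ (proper-count circuit S⊂C nonempty) balanced) (*-monoʳ-≤ 2 (p⊆q⇒∣p∣≤∣q∣ V⊆W))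

  circuit-no-small-cut : ∀ {C} → Circuit G C → (R : Subset n) {e f : Fin (m G)} →
    e ∈ C → Crosses R e → f ∈ C → e ≢ f → ∣ cut-part C R ∣ ≤ 2 → ⊥
  circuit-no-small-cut {C} circuit R {e} {f} e∈C e-crosses f∈C e≢f cut≤2 =
    circuit-uncounted circuit ((λ balanced → balanced-count balanced (nonempty? Cin) (nonempty? Cout))
                              , absorb-slack (∣ C ∣) (∣ V ∣) 2 (whole 2 2 in-count out-count) ≤-refl)
    where
    Cin Cout : Subset (m G)
    Cin = inside-part C R
    Cout = outside-part C R
    V : Subset n
    V = VS G C

    -- e crosses R: it lies in neither side, and it has an end on each side.
    Cin⊂C : Cin ⊂ C
    Cin⊂C = p∩q⊆p C _ , e , e∈C , λ e∈ → crosses⇒¬inside e-crosses (∈⟪⟫⁻ (inside? R) (p∩q⊆q C _ e∈))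
    Cout⊂C : Cout ⊂ C
    Cout⊂C = p∩q⊆p C _ , e , e∈C , λ e∈ → crosses⇒¬outside e-crosses (∈⟪⟫⁻ (outside? R) (p∩q⊆q C _ e∈))
    e-ends : Exit.inner (exit e-crosses) ∈ V ∩ R × Exit.outer (exit e-crosses) ∈ V ∩ ∁ R
    e-ends = exit-ends e∈C (exit e-crosses)

    in-count : ∣ Cin ∣ + 2 ≤ 2 * ∣ V ∩ R ∣
    in-count = part-count circuit Cin⊂C (inside-vertices C R) (∈⇒1≤∣p∣ (proj₁ e-ends))
    out-count : ∣ Cout ∣ + 2 ≤ 2 * ∣ V ∩ ∁ R ∣
    out-count = part-count circuit Cout⊂C (outside-vertices C R) (∈⇒1≤∣p∣ (proj₂ e-ends))

    in-balanced : Balanced G C → Nonempty Cin → ∣ Cin ∣ + 3 ≤ 2 * ∣ V ∩ R ∣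
    in-balanced balanced some-in = part-count-balanced circuit Cin⊂C (inside-vertices C R) some-in
      (balanced-mono (p∩q⊆p C _) balanced)
    out-balanced : Balanced G C → Nonempty Cout → ∣ Cout ∣ + 3 ≤ 2 * ∣ V ∩ ∁ R ∣
    out-balanced balanced some-out = part-count-balanced circuit Cout⊂C (outside-vertices C R) some-out
      (balanced-mono (p∩q⊆p C _) balanced)

    whole : ∀ c₁ c₂ → ∣ Cin ∣ + c₁ ≤ 2 * ∣ V ∩ R ∣ → ∣ Cout ∣ + c₂ ≤ 2 * ∣ V ∩ ∁ R ∣ →
      ∣ C ∣ + (c₁ + c₂) ≤ 2 * ∣ V ∣ + 2
    whole = count-across-cut C R cut≤2

    -- In the balanced case a nonempty side gains one unit of slack; if both
    -- sides are empty, C consists of at most two crossing edges, which have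
    -- at least three ends.
    balanced-count : Balanced G C → Dec (Nonempty Cin) → Dec (Nonempty Cout) → ∣ C ∣ + 3 ≤ 2 * ∣ V ∣
    balanced-count balanced (yes some-in) (yes some-out) =
      absorb-slack (∣ C ∣) (∣ V ∣) 3
        (whole 3 3 (in-balanced balanced some-in) (out-balanced balanced some-out)) (n≤1+n 5)
    balanced-count balanced (yes some-in) (no _) =
      absorb-slack (∣ C ∣) (∣ V ∣) 3 (whole 3 2 (in-balanced balanced some-in) out-count) ≤-refl
    balanced-count balanced (no _) (yes some-out) =
      absorb-slack (∣ C ∣) (∣ V ∣) 3 (whole 2 3 in-count (out-balanced balanced some-out)) ≤-refl
    balanced-count balanced (no no-in) (no no-out) = small-count C≤2 (subst (3 ≤_)
      (sym (∣p∣≡∣p∩q∣+∣p∩∁q∣ V R)) (crossing-pair-ends balanced e∈C f∈C e≢f e-crosses f-crosses))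
      where
      C≤2 : ∣ C ∣ ≤ 2
      C≤2 = ≤-trans (cut-split C R) (subst₂ (λ x y → (x + y) + ∣ cut-part C R ∣ ≤ 2)
                      (sym (∣∅∣≡0 Cin no-in)) (sym (∣∅∣≡0 Cout no-out)) cut≤2)
      f-crosses : Crosses R f
      f-crosses with classify R f
      ... | inj₁ inside = ⊥-elim (no-in (f , x∈p∩q⁺ (f∈C , ∈⟪⟫⁺ (inside? R) inside)))
      ... | inj₂ (inj₁ outside) = ⊥-elim (no-out (f , x∈p∩q⁺ (f∈C , ∈⟪⟫⁺ (outside? R) outside)))
      ... | inj₂ (inj₂ crosses) = crosses

  snoc : ∀ {Ok : Fin (m G) → Set} {a b c δ i} → Walk G Ok a b → Ok i →
    Traverses G (E G i) b c δ → Walk G Ok a c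
  snoc nil ok t = cons _ ok t nil
  snoc (cons j ok′ t′ w) ok t = cons j ok′ t′ (snoc w ok t)

  crossing-edge : ∀ {Ok : Fin (m G) → Set} {y z} (R : Subset n) → Walk G Ok y z →
    y ∈ R → z ∉ R → ∃ (Crosses R)
  crossing-edge R nil y∈R y∉R = ⊥-elim (y∉R y∈R)
  crossing-edge R (cons {y = w} i _ t walk) y∈R z∉R with w ∈? R
  ... | yes w∈R = crossing-edge R walk w∈R z∉R
  ... | no w∉R = i , exit-crosses (record { traversal = t ; inner∈R = y∈R ; outer∉R = w∉R })

  record Component (Ok : Fin (m G) → Set) (y : Fin n) : Set where
    field
      R : Subset n
      root : y ∈ R
      walk-to : ∀ {v} → v ∈ R → Walk G Ok y v
      closed : ∀ {i} → Ok i → ¬ Crosses R i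

  -- Grow R from {y}, adding the far end of an admissible crossing edge as
  -- long as there is one; this terminates since R strictly increases.
  component : ∀ {Ok : Fin (m G) → Set} → (∀ i → Dec (Ok i)) → ∀ y → Component Ok y
  component {Ok} Ok? y = grow ⁅ y ⁆ (⊃-wellFounded _) (x∈⁅x⁆ y)
    (λ v∈⁅y⁆ → subst (Walk G Ok y) (sym (x∈⁅y⁆⇒x≡y y v∈⁅y⁆)) nil)
    where
    grow : ∀ R → Acc _⊃_ R → y ∈ R → (∀ {v} → v ∈ R → Walk G Ok y v) → Component Ok y
    grow R (acc larger) y∈R walk-to with any? (λ i → Ok? i ×-dec crosses? R i)
    ... | no none = record { R = R ; root = y∈R ; walk-to = walk-to ; closed = λ ok c → none (_ , ok , c) }
    ... | yes (i , ok , crosses) =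
      grow (R ∪ ⁅ outer ⁆) (larger R⊂R′) (x∈p∪q⁺ (inj₁ y∈R)) walk-to′
      where
      open Exit (exit crosses)
      R⊂R′ : R ⊂ R ∪ ⁅ outer ⁆
      R⊂R′ = p⊆p∪q _ , outer , x∈p∪q⁺ (inj₂ (x∈⁅x⁆ outer)) , outer∉R
      walk-to′ : ∀ {v} → v ∈ R ∪ ⁅ outer ⁆ → Walk G Ok y v
      walk-to′ v∈ with x∈p∪q⁻ R ⁅ outer ⁆ v∈
      ... | inj₁ v∈R = walk-to v∈R
      ... | inj₂ v∈⁅outer⁆ = subst (Walk G Ok y) (sym (x∈⁅y⁆⇒x≡y outer v∈⁅outer⁆))
                                  (snoc (walk-to inner∈R) ok traversal)

  ExitsAt : Subset n → Fin n → Set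
  ExitsAt R x = ∀ {i} (out : Exit R i) → Exit.outer out ≡ x

  Touches : Subset n → Fin (m G) → Set
  Touches R i = tl i ∈ R ⊎ hd i ∈ R

  touches? : ∀ R i → Dec (Touches R i)
  touches? R i = (tl i ∈? R) ⊎-dec (hd i ∈? R)

  touches : ∀ {R i u} → Ends i u → u ∈ R → Touches R i
  touches (inj₁ tl≡u) u∈R = inj₁ (subst (_∈ _) (sym tl≡u) u∈R)
  touches (inj₂ hd≡u) u∈R = inj₂ (subst (_∈ _) (sym hd≡u) u∈R)

  exits-through : ∀ {R i u} → Touches R i → Ends i u → u ∉ R → Σ (Exit R i) λ out → Exit.outer out ≡ u
  exits-through (inj₁ tl∈R) (inj₁ tl≡u) u∉R = ⊥-elim (u∉R (subst (_∈ _) tl≡u tl∈R))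
  exits-through (inj₂ hd∈R) (inj₂ hd≡u) u∉R = ⊥-elim (u∉R (subst (_∈ _) hd≡u hd∈R))
  exits-through (inj₁ tl∈R) (inj₂ hd≡u) u∉R =
    record { traversal = inj₁ (refl , refl , refl) ; inner∈R = tl∈R ; outer∉R = subst (_∉ _) (sym hd≡u) u∉R } , hd≡u
  exits-through (inj₂ hd∈R) (inj₁ tl≡u) u∉R =
    record { traversal = inj₂ (refl , refl , refl) ; inner∈R = hd∈R ; outer∉R = subst (_∉ _) (sym tl≡u) u∉R } , tl≡u

  -- If all edges leaving R leave at x, an edge at y ∈ R and an edge at z ∉ R
  -- (z ≠ x) cannot lie on a common circuit: the edges touching R and the
  -- others would split it at x.
  no-vertex-separation : MConnected G → (R : Subset n) (x : Fin n) → ExitsAt R x →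
    ∀ {y z} → y ∈ R → InV G y → z ∉ R → InV G z → z ≢ x → ⊥
  no-vertex-separation (_ , circuits) R x exits-at-x y∈R (e , e-at-y) z∉R (f , f-at-z) z≢x =
    circuit-no-cut-vertex circuit T e∈C e∈T f∈C f∉T x shared
    where
    T : Subset (m G)
    T = ⟪ touches? R ⟫
    e∈T : e ∈ T
    e∈T = ∈⟪⟫⁺ (touches? R) (touches e-at-y y∈R)
    f∉T : f ∉ T
    f∉T f∈T with exits-through (∈⟪⟫⁻ (touches? R) f∈T) f-at-z z∉R
    ... | out , outer≡z = z≢x (trans (sym outer≡z) (exits-at-x out))
    common : ∃ λ C → Circuit G C × e ∈ C × f ∈ C
    common = circuits e f (λ e≡f → f∉T (subst (_∈ T) e≡f e∈T))
    C : Subset (m G)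
    C = proj₁ common
    circuit : Circuit G C
    circuit = proj₁ (proj₂ common)
    e∈C : e ∈ C
    e∈C = proj₁ (proj₂ (proj₂ common))
    f∈C : f ∈ C
    f∈C = proj₂ (proj₂ (proj₂ common))
    -- A shared vertex u is outside R (an end of an edge not touching R), so the
    -- edge of C ∩ T at u leaves R at u.
    shared : ∀ {u} → u ∈ VS G (C ∩ T) → u ∈ VS G (C ∩ ∁ T) → u ≡ x
    shared {u} u∈V₁ u∈V₂ with VS⁻ u∈V₁ | VS⁻ u∈V₂
    ... | i , i∈C∩T , i-at-u | j , j∈C∖T , j-at-u =
      trans (sym (proj₂ leaves)) (exits-at-x (proj₁ leaves))
      where
      u∉R : u ∉ R
      u∉R u∈R = x∈∁p⇒x∉p (p∩q⊆q C (∁ T) j∈C∖T) (∈⟪⟫⁺ (touches? R) (touches j-at-u u∈R))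
      leaves : Σ (Exit R i) λ out → Exit.outer out ≡ u
      leaves = exits-through (∈⟪⟫⁻ (touches? R) (p∩q⊆q C T i∈C∩T)) i-at-u u∉R

  connected : MConnected G → Connected G
  connected mc y z y∈V z∈V = walk (z ∈? R)
    where
    open Component (component {Ok = λ _ → ⊤} (λ _ → yes tt) y)
    walk : Dec (z ∈ R) → Walk G (λ _ → ⊤) y z
    walk (yes z∈R) = walk-to z∈R
    walk (no z∉R) = ⊥-elim (no-vertex-separation mc R y exits-nowhere root y∈V z∉R z∈V
                              (λ z≡y → z∉R (subst (_∈ R) (sym z≡y) root)))
      where
      exits-nowhere : ExitsAt R y
      exits-nowhere out = ⊥-elim (closed tt (exit-crosses out))

  Avoids : Fin n → Fin (m G) → Set
  Avoids x i = tl i ≢ x × hd i ≢ x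

  avoids? : ∀ x i → Dec (Avoids x i)
  avoids? x i = ¬? (tl i ≟ x) ×-dec ¬? (hd i ≟ x)

  traversal-avoids : ∀ {x i a b δ} → Traverses G (E G i) a b δ → a ≢ x → b ≢ x → Avoids x i
  traversal-avoids (inj₁ (tl≡a , hd≡b , _)) a≢x b≢x = a≢x ∘ trans (sym tl≡a) , b≢x ∘ trans (sym hd≡b)
  traversal-avoids (inj₂ (hd≡a , tl≡b , _)) a≢x b≢x = b≢x ∘ trans (sym tl≡b) , a≢x ∘ trans (sym hd≡a)

  walk-avoids : ∀ {x a b} → Walk G (Avoids x) a b → a ≢ x → b ≢ x
  walk-avoids nil a≢x = a≢x
  walk-avoids {x} (cons i (tl≢x , hd≢x) t walk) _ = walk-avoids walk (end≢x (proj₂ (traversal-ends t)))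
    where
    end≢x : ∀ {u} → Ends i u → u ≢ x
    end≢x (inj₁ tl≡u) = tl≢x ∘ trans tl≡u
    end≢x (inj₂ hd≡u) = hd≢x ∘ trans hd≡u

  -- G - x is connected: the component R of y in G - x avoids x, so every
  -- edge leaving R leaves it at x.
  two-connected : MConnected G → ∀ x → InV G x → ∀ y z → InV G y → InV G z → y ≢ x → z ≢ x →
    Walk G (Avoids x) y z
  two-connected mc x _ y z y∈V z∈V y≢x z≢x = walk (z ∈? R)
    where
    open Component (component (avoids? x) y)
    R∌x : ∀ {v} → v ∈ R → v ≢ x
    R∌x v∈R = walk-avoids (walk-to v∈R) y≢x
    exits-at-x : ExitsAt R x
    exits-at-x out with Exit.outer out ≟ x
    ... | yes outer≡x = outer≡x
    ... | no outer≢x = ⊥-elim (closed (traversal-avoids traversal (R∌x inner∈R) outer≢x) (exit-crosses out))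
      where open Exit out
    walk : Dec (z ∈ R) → Walk G (Avoids x) y z
    walk (yes z∈R) = walk-to z∈R
    walk (no z∉R) = ⊥-elim (no-vertex-separation mc R x exits-at-x root y∈V z∉R z∈V z≢x)

  -- G - S is connected for |S| ≤ 2: otherwise the component R of y in G - S
  -- is crossed by some edge e of the connected graph G, and a circuit
  -- through e and any other edge is crossed only by edges of S.
  three-edge-connected : MConnected G → ∀ (S : Subset (m G)) → ∣ S ∣ ≤ 2 → ∀ y z → InV G y → InV G z →
    Walk G (λ i → i ∉ S) y z
  three-edge-connected mc@(2≤m , circuits) S S≤2 y z y∈V z∈V = walk (z ∈? R)
    where
    open Component (component (λ i → ¬? (i ∈? S)) y)
    walk : Dec (z ∈ R) → Walk G (λ i → i ∉ S) y z
    walk (yes z∈R) = walk-to z∈R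
    walk (no z∉R) with crossing-edge R (connected mc y z y∈V z∈V) root z∉R
    ... | e , e-crosses with another-edge 2≤m e
    ...   | f , e≢f with circuits e f e≢f
    ...     | C , circuit , e∈C , f∈C =
      ⊥-elim (circuit-no-small-cut circuit R e∈C e-crosses f∈C e≢f (≤-trans (p⊆q⇒∣p∣≤∣q∣ cut⊆S) S≤2))
      where
      -- Admissible edges do not cross R, so the crossing edges of C are in S.
      cut⊆S : cut-part C R ⊆ S
      cut⊆S {i} i∈cut = decidable-stable (i ∈? S)
        (λ i∉S → closed i∉S (∈⟪⟫⁻ (crosses? R) (p∩q⊆q C _ i∈cut)))

lemma5p8 : ∀ {n k : ℕ} (G : LGraph n k) → MConnected G →
    TwoConnected G × ThreeEdgeConnected G
lemma5p8 G mc = (connected G mc , two-connected G mc) , (connected G mc , three-edge-connected G mc)
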